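{- Let $\mathcal G\supseteq \mathrm{Aut}(\mathbb P)$ be a closed subgroup of $\mathrm{Sym}_P$, let $c_1,\ldots,c_n\in P$, and let $g:(\mathbb P,c_1,\ldots,c_n)\to\mathbb P$ be a canonical function M-generated by $\mathcal G$. Then either $\mathcal G=\mathrm{Sym}_P$, or on each infinite orbit $X$ of $(\mathbb P,c_1,\ldots,c_n)$ the function $g$ behaves like $\mathrm{id}$ or like $\updownarrow$.
   Context: $\mathbb P=(P;\leq)$ is the random partial order: the unique (up to isomorphism) countable homogeneous partial order into which every finite partial order embeds. Write $x<y$ for $x\le y, x\neq y$, and $x\perp y$ if $x,y$ are incomparable. $\mathrm{Sym}_P$ carries the topology of pointwise convergence. The orbits of $(\mathbb P,c_1,\ldots,c_n)$ are the orbits on $P$ of the pointwise stabilizer of $c_1,\ldots,c_n$ in $\mathrm{Aut}(\mathbb P)$; two $k$-tuples have the same type in $(\mathbb P,c_1,\dots,c_n)$ (resp. in $\mathbb P$) if some automorphism of $\mathbb P$ fixing each $c_i$ (resp. some automorphism of $\mathbb P$) maps one to the other. A function $g:P\to P$ is canonical from $(\mathbb P,c_1,\ldots,c_n)$ to $\mathbb P$ if for all $k$ and all $k$-tuples $a,b$ of the same type in $(\mathbb P,c_1,\ldots,c_n)$, $g(a)$ and $g(b)$ (componentwise) have the same type in $\mathbb P$. A function $g:P\to P$ is M-generated by $\mathcal G$ if for every finite $A\subseteq P$ there is $h\in\mathcal G$ agreeing with $g$ on $A$. For $X\subseteq P$, $g$ behaves like $\mathrm{id}$ on $X$ if for all $x,x'\in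 X$, $x<x'$ implies $g(x)<g(x')$ and $x\perp x'$ implies $g(x)\perp g(x')$; $g$ behaves like $\updownarrow$ on $X$ if for all $x,x'\in X$, $x<x'$ implies $g(x)>g(x')$ and $x\perp x'$ implies $g(x)\perp g(x')$. -}

module Defs where

open import Level using (0ℓ)
open import Data.Nat using (ℕ)
open import Data.Fin using (Fin)
open import Data.List using (List)
open import Data.List.Membership.Propositional using (_∈_)
open import Data.Product using (Σ; ∃; ∃-syntax; _×_; _,_)
open import Data.Sum using (_⊎_)
open import Function using (_∘_; id)
open import Relation.Nullary using (¬_)
open import Relation.Binary.Core using (Rel)
open import Relation.Binary.Structures using (IsPartialOrder)
open import Relation.Binary.PropositionalEquality using (_≡_; _≢_)

Iff : Set → Set → Set
Iff A B = (A → B) × (B → A)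

module _ {P : Set} (_≤_ : Rel P 0ℓ) where

  _<ₚ_ : P → P → Set
  x <ₚ y = (x ≤ y) × (x ≢ y)

  _⊥ₚ_ : P → P → Set
  x ⊥ₚ y = (¬ (x ≤ y)) × (¬ (y ≤ x))

  IsPerm : (P → P) → Set
  IsPerm f = Σ (P → P) λ f⁻ → (∀ x → f (f⁻ x) ≡ x) × (∀ x → f⁻ (f x) ≡ x)

  IsAut : (P → P) → Set
  IsAut f = IsPerm f × (∀ x y → Iff (x ≤ y) (f x ≤ f y))

  Countable : Set
  Countable = Σ (ℕ → P) λ e → ∀ y → ∃[ m ] (e m ≡ y)

  Homogeneous : Set
  Homogeneous = ∀ (k : ℕ) (a b : Fin k → P) →
    (∀ i j → Iff (a i ≤ a j) (b i ≤ b j)) →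
    Σ (P → P) λ α → IsAut α × (∀ i → α (a i) ≡ b i)

  Universal : Set₁
  Universal = ∀ (k : ℕ) (R : Rel (Fin k) 0ℓ) → IsPartialOrder _≡_ R →
    Σ (Fin k → P) λ e → (∀ i j → e i ≡ e j → i ≡ j) ×
                        (∀ i j → Iff (R i j) (e i ≤ e j))

  IsRandomPartialOrder : Set₁
  IsRandomPartialOrder =
    IsPartialOrder _≡_ _≤_ × Countable × Homogeneous × Universal

  Fixes : ∀ {n} → (P → P) → (Fin n → P) → Set
  Fixes α c = ∀ i → α (c i) ≡ c i

  SameTypeOver : ∀ {n k} → (Fin n → P) → (Fin k → P) → (Fin k → P) → Set
  SameTypeOver c a b =
    Σ (P → P) λ α → IsAut α × Fixes α c × (∀ j → α (a j) ≡ b j)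

  SameType : ∀ {k} → (Fin k → P) → (Fin k → P) → Set
  SameType a b = Σ (P → P) λ α → IsAut α × (∀ j → α (a j) ≡ b j)

  Canonical : ∀ {n} → (Fin n → P) → (P → P) → Set
  Canonical c g = ∀ (k : ℕ) (a b : Fin k → P) →
    SameTypeOver c a b → SameType (g ∘ a) (g ∘ b)

  Orbit : ∀ {n} → (Fin n → P) → P → P → Set
  Orbit c x y = Σ (P → P) λ α → IsAut α × Fixes α c × (α x ≡ y)

  Infinite : (P → Set) → Set
  Infinite X = ¬ (Σ (List P) λ L → ∀ y → X y → y ∈ L)

  MGenerated : ((P → P) → Set) → (P → P) → Set
  MGenerated G g = ∀ (A : List P) →
    Σ (P → P) λ h → G h × (∀ x → x ∈ A → h x ≡ g x)

  -- G is a closed subgroup of Sym_P (topology of pointwise convergence)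
  IsClosedSubgroup : ((P → P) → Set) → Set
  IsClosedSubgroup G =
    (∀ f → G f → IsPerm f) ×
    G id ×
    (∀ f h → G f → G h → G (f ∘ h)) ×
    (∀ f → G f → (p : IsPerm f) → G (Σ.proj₁ p)) ×
    (∀ f → IsPerm f → MGenerated G f → G f)

  IsFullSym : ((P → P) → Set) → Set
  IsFullSym G = ∀ f → IsPerm f → G f

  BehavesLikeId : (P → P) → (P → Set) → Set
  BehavesLikeId g X = ∀ x x' → X x → X x' →
    (x <ₚ x' → g x <ₚ g x') × (x ⊥ₚ x' → g x ⊥ₚ g x')

  BehavesLikeFlip : (P → P) → (P → Set) → Set
  BehavesLikeFlip g X = ∀ x x' → X x → X x' →
    (x <ₚ x' → g x' <ₚ g x) × (x ⊥ₚ x' → g x ⊥ₚ g x')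

-- All points of the orbit X of x are related to the constants c alike, so by
-- homogeneity all pairs y < y′ in X have the same type over c, and so do all
-- incomparable pairs, in either order.  Canonicity then forces g to keep
-- incomparable pairs of X incomparable, and to send all strict pairs of X in
-- one and the same direction: upwards (id), downwards (↕), or to incomparable
-- pairs.  In the last case g maps X onto an antichain.  As X is infinite, x is
-- none of the constants, so by universality and homogeneity every finite
-- partial order has a copy inside X; composing with g, every finite set is sent
-- onto an antichain by an element of G.  Any two antichains of the same size
-- are related by an automorphism, so G agrees with each permutation on each
-- finite set, and being closed it is all of Sym_P.
module Submission where

open import Defs
open import Level using (0ℓ)
open import Data.Nat using (ℕ; _+_)
open import Data.Fin using (Fin; zero; suc; splitAt; join; _↑ˡ_; _↑ʳ_)
open import Data.Fin.Properties using (splitAt-join; join-splitAt) renaming (_≟_ to _≟ᶠ_)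
open import Data.Vec.Functional using (_++_)
open import Data.Vec.Functional.Properties using (lookup-++ˡ; lookup-++ʳ)
open import Data.Sum using (_⊎_; inj₁; inj₂)
open import Data.Product using (Σ; ∃-syntax; _×_; _,_; proj₁; proj₂)
open import Data.List using (List; []; _∷_; length; lookup; tabulate; deduplicate)
open import Data.List.Relation.Unary.Any using (here; there; index)
open import Data.List.Relation.Unary.Any.Properties using (lookup-index)
import Data.List.Relation.Unary.All as All
open import Data.List.Relation.Unary.AllPairs using (_∷_)
open import Data.List.Relation.Unary.Unique.Propositional using (Unique)
open import Data.List.Relation.Unary.Unique.DecPropositional.Properties using (deduplicate-!)
open import Data.List.Membership.Propositional using (_∈_)
open import Data.List.Membership.Propositional.Properties
  using (∈-lookup; ∈-tabulate⁺; ∈-tabulate⁻; ∈-deduplicate⁺; ∈-deduplicate⁻)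
open import Data.Empty using (⊥-elim)
open import Function using (_∘_; _on_)
open import Function.Definitions using (Injective)
open import Relation.Nullary using (¬_; Dec; yes; no)
open import Relation.Binary.Core using (Rel)
open import Relation.Binary.Definitions using (DecidableEquality)
open import Relation.Binary.Structures using (IsPartialOrder)
open import Relation.Binary.PropositionalEquality
  using (_≡_; _≢_; refl; sym; trans; cong; subst₂; isEquivalence)
open import Axiom.ExcludedMiddle using (ExcludedMiddle)

Iff-refl : {A : Set} → Iff A A
Iff-refl = (λ a → a) , (λ a → a)

Iff-sym : {A B : Set} → Iff A B → Iff B A
Iff-sym (f , g) = g , f

Iff-trans : {A B C : Set} → Iff A B → Iff B C → Iff A C
Iff-trans (f , g) (f′ , g′) = f′ ∘ f , g ∘ g′

module _ {A : Set} where

  lookup-injective : {xs : List A} → Unique xs → Injective _≡_ _≡_ (lookup xs)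
  lookup-injective {_ ∷ _} _ {zero} {zero} _ = refl
  lookup-injective {_ ∷ _} (x∉xs ∷ _) {zero} {suc j} eq =
    ⊥-elim (All.lookup x∉xs (∈-lookup j) eq)
  lookup-injective {_ ∷ _} (x∉xs ∷ _) {suc i} {zero} eq =
    ⊥-elim (All.lookup x∉xs (∈-lookup i) (sym eq))
  lookup-injective {_ ∷ _} (_ ∷ distinct) {suc i} {suc j} eq =
    cong suc (lookup-injective distinct eq)

  injectiveEnumeration : DecidableEquality A → (xs : List A) →
    Σ ℕ λ m → Σ (Fin m → A) λ u → Injective _≡_ _≡_ u ×
      (∀ {y} → y ∈ xs → ∃[ r ] u r ≡ y) × (∀ r → u r ∈ xs)
  injectiveEnumeration _≟_ xs =
    length D , lookup D , lookup-injective (deduplicate-! _≟_ xs) , covers ,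
    λ r → ∈-deduplicate⁻ _≟_ xs (∈-lookup r)
    where
    D : List A
    D = deduplicate _≟_ xs
    covers : ∀ {y} → y ∈ xs → ∃[ r ] lookup D r ≡ y
    covers {y} y∈xs = index y∈D , sym (lookup-index y∈D)
      where
      y∈D : y ∈ D
      y∈D = ∈-deduplicate⁺ _≟_ y∈xs

isPartialOrder-onInjective : {A B : Set} {R : Rel A 0ℓ} (f : B → A) →
  Injective _≡_ _≡_ f → IsPartialOrder _≡_ R → IsPartialOrder _≡_ (R on f)
isPartialOrder-onInjective f f-inj po = record
  { isPreorder = record
    { isEquivalence = isEquivalence
    ; reflexive = λ { refl → IsPartialOrder.refl po }
    ; trans = IsPartialOrder.trans po }
  ; antisym = λ r r′ → f-inj (IsPartialOrder.antisym po r r′) }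

module _ {P : Set} (_≤_ : Rel P 0ℓ) where

  private
    _<_ : P → P → Set
    _<_ = _<ₚ_ _≤_
    _⊥_ : P → P → Set
    _⊥_ = _⊥ₚ_ _≤_

  pair : P → P → Fin 2 → P
  pair y y′ zero    = y
  pair y y′ (suc _) = y′

  OrderIsomorphic : ∀ {k} → (Fin k → P) → (Fin k → P) → Set
  OrderIsomorphic a b = ∀ i j → Iff (a i ≤ a j) (b i ≤ b j)

  SameRelationsOver : ∀ {n} → (Fin n → P) → P → P → Set
  SameRelationsOver c y z = ∀ q → Iff (y ≤ c q) (z ≤ c q) × Iff (c q ≤ y) (c q ≤ z)

  Antichain : ∀ {k} → (Fin k → P) → Set
  Antichain a = ∀ i j → i ≢ j → a i ⊥ a j

  SendsToAntichain : (P → P) → (P → Set) → Set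
  SendsToAntichain g X = ∀ y y′ → X y → X y′ → y ≢ y′ → g y ⊥ g y′

  FlattensToAntichains : ((P → P) → Set) → Set
  FlattensToAntichains G = ∀ {k} (a : Fin k → P) → Injective _≡_ _≡_ a →
    Σ (P → P) λ h → G h × Antichain (h ∘ a)

  isPerm-injective : ∀ {f} → IsPerm _≤_ f → Injective _≡_ _≡_ f
  isPerm-injective (f⁻ , _ , f⁻∘f) {a} {b} eq =
    trans (sym (f⁻∘f a)) (trans (cong f⁻ eq) (f⁻∘f b))

  isAut-Iff : ∀ {α} → IsAut _≤_ α → ∀ {a b a′ b′} → α a ≡ a′ → α b ≡ b′ →
    Iff (a ≤ b) (a′ ≤ b′)
  isAut-Iff aut {a} {b} αa αb =
    subst₂ (λ a′ b′ → Iff (a ≤ b) (a′ ≤ b′)) αa αb (proj₂ aut a b)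

  mgenerated-injective : ∀ {G g} → (∀ f → G f → IsPerm _≤_ f) → MGenerated _≤_ G g →
    Injective _≡_ _≡_ g
  mgenerated-injective perm mg {y} {y′} eq with mg (y ∷ y′ ∷ [])
  ... | h , Gh , h≗g = isPerm-injective (perm h Gh)
    (trans (h≗g y (here refl)) (trans eq (sym (h≗g y′ (there (here refl))))))

  sameRelationsOver-sym : ∀ {n} {c : Fin n → P} {y z} →
    SameRelationsOver c y z → SameRelationsOver c z y
  sameRelationsOver-sym y~z q = Iff-sym (proj₁ (y~z q)) , Iff-sym (proj₂ (y~z q))

  sameRelationsOver-trans : ∀ {n} {c : Fin n → P} {y z w} →
    SameRelationsOver c y z → SameRelationsOver c z w → SameRelationsOver c y w
  sameRelationsOver-trans y~z z~w q =
    Iff-trans (proj₁ (y~z q)) (proj₁ (z~w q)) , Iff-trans (proj₂ (y~z q)) (proj₂ (z~w q))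

  sameRelationsOver-⊆ : ∀ {m n} {u : Fin m → P} {c : Fin n → P} {y z} →
    (∀ q → ∃[ r ] u r ≡ c q) → SameRelationsOver u y z → SameRelationsOver c y z
  sameRelationsOver-⊆ {y = y} {z} c⊆u y~z q with c⊆u q
  ... | r , ur≡cq =
    subst₂ (λ s t → Iff (y ≤ s) (z ≤ s) × Iff (t ≤ y) (t ≤ z)) ur≡cq ur≡cq (y~z r)

  orbit⇒sameRelationsOver : ∀ {n} {c : Fin n → P} {x y} →
    Orbit _≤_ c x y → SameRelationsOver c x y
  orbit⇒sameRelationsOver (α , aut , fixes , αx) q =
    isAut-Iff aut αx (fixes q) , isAut-Iff aut (fixes q) αx

  infiniteOrbit-avoidsConstants : ∀ {n} {c : Fin n → P} {x} →
    Infinite _≤_ (Orbit _≤_ c x) → ∀ q → x ≢ c q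
  infiniteOrbit-avoidsConstants {c = c} infinite q refl =
    infinite (c q ∷ [] , λ { _ (_ , _ , fixes , refl) → here (fixes q) })

  universal-⊎ : Universal _≤_ → ∀ {k m} (R : Rel (Fin k ⊎ Fin m) 0ℓ) → IsPartialOrder _≡_ R →
    Σ (Fin k ⊎ Fin m → P) λ e → ∀ s t → Iff (R s t) (e s ≤ e t)
  universal-⊎ univ {k} {m} R po
    with univ (k + m) (R on splitAt k) (isPartialOrder-onInjective (splitAt k) splitAt-injective po)
    where
    splitAt-injective : Injective _≡_ _≡_ (splitAt k {m})
    splitAt-injective {i} {j} eq =
      trans (sym (join-splitAt k m i)) (trans (cong (join k m) eq) (join-splitAt k m j))
  ... | e , _ , e-iso = e ∘ join k m , λ s t →
    subst₂ (λ s′ t′ → Iff (R s′ t′) (e (join k m s) ≤ e (join k m t)))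
      (splitAt-join k m s) (splitAt-join k m t) (e-iso (join k m s) (join k m t))

  module _ (isPO : IsPartialOrder _≡_ _≤_) where

    open IsPartialOrder isPO using (antisym; reflexive) renaming (refl to ≤-refl; trans to ≤-trans)

    <⇒≱ : ∀ {y y′} → y < y′ → ¬ (y′ ≤ y)
    <⇒≱ (y≤y′ , y≢y′) y′≤y = y≢y′ (antisym y≤y′ y′≤y)

    antichain-orderIsomorphic : ∀ {k} {a b : Fin k → P} →
      Antichain a → Antichain b → OrderIsomorphic a b
    antichain-orderIsomorphic a⊥ b⊥ i j with i ≟ᶠ j
    ... | yes refl = (λ _ → ≤-refl) , (λ _ → ≤-refl)
    ... | no i≢j   = ⊥-elim ∘ proj₁ (a⊥ i j i≢j) , ⊥-elim ∘ proj₁ (b⊥ i j i≢j)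

    orderIsomorphic-injective : ∀ {k} {a b : Fin k → P} → OrderIsomorphic a b →
      Injective _≡_ _≡_ a → Injective _≡_ _≡_ b
    orderIsomorphic-injective a≅b a-inj {i} {j} bi≡bj =
      a-inj (antisym (proj₂ (a≅b i j) (reflexive bi≡bj)) (proj₂ (a≅b j i) (reflexive (sym bi≡bj))))

    module Substitution {k m} (a : Fin k → P) (u : Fin m → P) (x : P) where

      -- the order a substituted for the point x of x ∪ u
      _⊑_ : Rel (Fin k ⊎ Fin m) 0ℓ
      inj₁ p ⊑ inj₁ q  = a p ≤ a q
      inj₁ p ⊑ inj₂ r  = x ≤ u r
      inj₂ r ⊑ inj₁ p  = u r ≤ x
      inj₂ r ⊑ inj₂ r′ = u r ≤ u r′

      ⊑-isPartialOrder : Injective _≡_ _≡_ a → Injective _≡_ _≡_ u → (∀ r → x ≢ u r) →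
        IsPartialOrder _≡_ _⊑_
      ⊑-isPartialOrder a-inj u-inj x∉u = record
        { isPreorder = record
          { isEquivalence = isEquivalence
          ; reflexive = λ { {s} refl → ⊑-refl s }
          ; trans = λ {s} {t} {v} → ⊑-trans s t v }
        ; antisym = λ {s} {t} → ⊑-antisym s t }
        where
        ⊑-refl : ∀ s → s ⊑ s
        ⊑-refl (inj₁ _) = ≤-refl
        ⊑-refl (inj₂ _) = ≤-refl
        ⊑-trans : ∀ s t v → s ⊑ t → t ⊑ v → s ⊑ v
        ⊑-trans (inj₁ _) (inj₁ _) (inj₁ _) = ≤-trans
        ⊑-trans (inj₁ _) (inj₁ _) (inj₂ _) _ t⊑v = t⊑v
        ⊑-trans (inj₁ _) (inj₂ r) (inj₁ _) x≤ur ur≤x = ⊥-elim (x∉u r (antisym x≤ur ur≤x))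
        ⊑-trans (inj₁ _) (inj₂ _) (inj₂ _) = ≤-trans
        ⊑-trans (inj₂ _) (inj₁ _) (inj₁ _) s⊑t _ = s⊑t
        ⊑-trans (inj₂ _) (inj₁ _) (inj₂ _) = ≤-trans
        ⊑-trans (inj₂ _) (inj₂ _) (inj₁ _) = ≤-trans
        ⊑-trans (inj₂ _) (inj₂ _) (inj₂ _) = ≤-trans
        ⊑-antisym : ∀ s t → s ⊑ t → t ⊑ s → s ≡ t
        ⊑-antisym (inj₁ _) (inj₁ _) s⊑t t⊑s = cong inj₁ (a-inj (antisym s⊑t t⊑s))
        ⊑-antisym (inj₁ _) (inj₂ r) s⊑t t⊑s = ⊥-elim (x∉u r (antisym s⊑t t⊑s))
        ⊑-antisym (inj₂ r) (inj₁ _) s⊑t t⊑s = ⊥-elim (x∉u r (antisym t⊑s s⊑t))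
        ⊑-antisym (inj₂ _) (inj₂ _) s⊑t t⊑s = cong inj₂ (u-inj (antisym s⊑t t⊑s))

    module _ (hom : Homogeneous _≤_) where

      -- Embed the substitution order, then move the embedded copy of u back onto u.
      copyRelativeTo : Universal _≤_ → ∀ {k m} {u : Fin m → P} {x} →
        Injective _≡_ _≡_ u → (∀ r → x ≢ u r) → (a : Fin k → P) → Injective _≡_ _≡_ a →
        Σ (Fin k → P) λ d → OrderIsomorphic a d × (∀ p → SameRelationsOver u x (d p))
      copyRelativeTo univ {u = u} {x} u-inj x∉u a a-inj
        with universal-⊎ univ _⊑_ (⊑-isPartialOrder a-inj u-inj x∉u)
        where open Substitution a u x
      ... | e , e-iso with hom _ (e ∘ inj₂) u (λ r r′ → Iff-sym (e-iso (inj₂ r) (inj₂ r′)))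
      ... | α , aut , αe≗u =
        α ∘ e ∘ inj₁ ,
        (λ p q → Iff-trans (e-iso (inj₁ p) (inj₁ q)) (isAut-Iff aut refl refl)) ,
        λ p r → Iff-trans (e-iso (inj₁ p) (inj₂ r)) (isAut-Iff aut refl (αe≗u r)) ,
                Iff-trans (e-iso (inj₂ r) (inj₁ p)) (isAut-Iff aut (αe≗u r) refl)

      -- f agrees on A with h₂⁻¹ ∘ α ∘ h₁, where h₁ and h₂ flatten A and f(A) to
      -- antichains and the automorphism α carries one antichain onto the other.
      flattensToAntichains⇒fullSym : DecidableEquality P → ∀ {G} → IsClosedSubgroup _≤_ G →
        (∀ f → IsAut _≤_ f → G f) → FlattensToAntichains G → IsFullSym _≤_ G
      flattensToAntichains⇒fullSym _≟_ {G} (perm , _ , comp , inv , closure) autG flatten f f-perm =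
        closure f f-perm agreesOnFinite
        where
        agreesOnFinite : MGenerated _≤_ G f
        agreesOnFinite A with injectiveEnumeration _≟_ A
        ... | m , u , u-inj , covers , _
          with flatten u u-inj | flatten (f ∘ u) (u-inj ∘ isPerm-injective f-perm)
        ... | h₁ , Gh₁ , h₁u⊥ | h₂ , Gh₂ , h₂fu⊥
          with hom m (h₁ ∘ u) (h₂ ∘ f ∘ u) (antichain-orderIsomorphic h₁u⊥ h₂fu⊥)
        ... | α , aut , α≗ = h₂⁻ ∘ α ∘ h₁ , Gh , agrees
          where
          h₂⁻ : P → P
          h₂⁻ = proj₁ (perm h₂ Gh₂)
          h₂⁻∘h₂ : ∀ y → h₂⁻ (h₂ y) ≡ y
          h₂⁻∘h₂ = proj₂ (proj₂ (perm h₂ Gh₂))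
          Gh : G (h₂⁻ ∘ α ∘ h₁)
          Gh = comp h₂⁻ (α ∘ h₁) (inv h₂ Gh₂ (perm h₂ Gh₂)) (comp α h₁ (autG α aut) Gh₁)
          agrees : ∀ y → y ∈ A → h₂⁻ (α (h₁ y)) ≡ f y
          agrees y y∈A with covers y∈A
          ... | r , refl = trans (cong h₂⁻ (α≗ r)) (h₂⁻∘h₂ (f (u r)))

      module _ {n} (c : Fin n → P) where

        homogeneousOver : ∀ {k} {a b : Fin k → P} → OrderIsomorphic a b →
          (∀ i → SameRelationsOver c (a i) (b i)) → SameTypeOver _≤_ c a b
        homogeneousOver {k} {a} {b} a≅b a~b
          with hom (k + n) (a ++ c) (b ++ c) extended-iso
          where
          extended-iso : OrderIsomorphic (a ++ c) (b ++ c)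
          extended-iso i j with splitAt k i | splitAt k j
          ... | inj₁ p | inj₁ p′ = a≅b p p′
          ... | inj₁ p | inj₂ q  = proj₁ (a~b p q)
          ... | inj₂ q | inj₁ p  = proj₂ (a~b p q)
          ... | inj₂ q | inj₂ q′ = Iff-refl
        ... | α , aut , α≗ = α , aut , fixes , moves
          where
          moves : ∀ p → α (a p) ≡ b p
          moves p = trans (cong α (sym (lookup-++ˡ a c p))) (trans (α≗ (p ↑ˡ n)) (lookup-++ˡ b c p))
          fixes : Fixes _≤_ α c
          fixes q = trans (cong α (sym (lookup-++ʳ a c q))) (trans (α≗ (k ↑ʳ q)) (lookup-++ʳ b c q))

        sameRelationsOver⇒orbit : ∀ {x y} → SameRelationsOver c x y → Orbit _≤_ c x y
        sameRelationsOver⇒orbit {x} {y} x~y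
          with homogeneousOver {1} {λ _ → x} {λ _ → y}
                 (λ _ _ → (λ _ → ≤-refl) , (λ _ → ≤-refl)) (λ _ → x~y)
        ... | α , aut , fixes , αx = α , aut , fixes , αx zero

        orbitPairs-sameTypeOver : ∀ {x y y′ z z′} →
          Orbit _≤_ c x y → Orbit _≤_ c x y′ → Orbit _≤_ c x z → Orbit _≤_ c x z′ →
          Iff (y ≤ y′) (z ≤ z′) → Iff (y′ ≤ y) (z′ ≤ z) →
          SameTypeOver _≤_ c (pair y y′) (pair z z′)
        orbitPairs-sameTypeOver {x} {y} {y′} {z} {z′} Xy Xy′ Xz Xz′ up down =
          homogeneousOver iso alike
          where
          iso : OrderIsomorphic (pair y y′) (pair z z′)
          iso zero    zero    = (λ _ → ≤-refl) , (λ _ → ≤-refl)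
          iso zero    (suc _) = up
          iso (suc _) zero    = down
          iso (suc _) (suc _) = (λ _ → ≤-refl) , (λ _ → ≤-refl)
          relate : ∀ {w w′} → Orbit _≤_ c x w → Orbit _≤_ c x w′ → SameRelationsOver c w w′
          relate Xw Xw′ = sameRelationsOver-trans
            (sameRelationsOver-sym (orbit⇒sameRelationsOver Xw)) (orbit⇒sameRelationsOver Xw′)
          alike : ∀ i → SameRelationsOver c (pair y y′ i) (pair z z′ i)
          alike zero    = relate Xy Xz
          alike (suc _) = relate Xy′ Xz′

        copyIntoOrbit : DecidableEquality P → Universal _≤_ → ∀ {x} → (∀ q → x ≢ c q) →
          ∀ {k} (a : Fin k → P) → Injective _≡_ _≡_ a →
          Σ (Fin k → P) λ d → OrderIsomorphic a d × (∀ p → Orbit _≤_ c x (d p))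
        copyIntoOrbit _≟_ univ {x} x∉c a a-inj with injectiveEnumeration _≟_ (tabulate c)
        ... | _ , u , u-inj , covers , u⊆c with copyRelativeTo univ u-inj x∉u a a-inj
          where
          x∉u : ∀ r → x ≢ u r
          x∉u r x≡ur with ∈-tabulate⁻ (u⊆c r)
          ... | q , ur≡cq = x∉c q (trans x≡ur ur≡cq)
        ... | d , a≅d , d~x = d , a≅d , λ p →
          sameRelationsOver⇒orbit (sameRelationsOver-⊆ (λ q → covers (∈-tabulate⁺ q)) (d~x p))

        orbitAntichain⇒flattensToAntichains : DecidableEquality P → Universal _≤_ →
          ∀ {G : (P → P) → Set} {g x} → (∀ f h → G f → G h → G (f ∘ h)) →
          (∀ f → IsAut _≤_ f → G f) → MGenerated _≤_ G g →
          (∀ q → x ≢ c q) → SendsToAntichain g (Orbit _≤_ c x) → FlattensToAntichains G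
        orbitAntichain⇒flattensToAntichains _≟_ univ {g = g} comp autG mg x∉c g⊥ a a-inj
          with copyIntoOrbit _≟_ univ x∉c a a-inj
        ... | d , a≅d , Xd with hom _ a d a≅d | mg (tabulate d)
        ... | γ , aut , γa≡d | h , Gh , h≗g = h ∘ γ , comp h γ Gh (autG γ aut) , antichain
          where
          hγa≡gd : ∀ i → h (γ (a i)) ≡ g (d i)
          hγa≡gd i = trans (cong h (γa≡d i)) (h≗g (d i) (∈-tabulate⁺ i))
          antichain : Antichain (h ∘ γ ∘ a)
          antichain i j i≢j = subst₂ _⊥_ (sym (hγa≡gd i)) (sym (hγa≡gd j))
            (g⊥ (d i) (d j) (Xd i) (Xd j) (i≢j ∘ orderIsomorphic-injective a≅d a-inj))

        module _ {g : P → P} (can : Canonical _≤_ c g) (g-inj : Injective _≡_ _≡_ g) where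

          canonical-pair : ∀ {y y′ z z′} → SameTypeOver _≤_ c (pair y y′) (pair z z′) →
            Iff (g y ≤ g y′) (g z ≤ g z′) × Iff (g y′ ≤ g y) (g z′ ≤ g z)
          canonical-pair same with can 2 _ _ same
          ... | β , aut , β≗ =
            isAut-Iff aut (β≗ zero) (β≗ (suc zero)) , isAut-Iff aut (β≗ (suc zero)) (β≗ zero)

          -- (y, y′) and (y′, y) have the same type, so g y ≤ g y′ iff g y′ ≤ g y.
          incomparable-preserved : ∀ {x y y′} → Orbit _≤_ c x y → Orbit _≤_ c x y′ →
            y ⊥ y′ → g y ⊥ g y′
          incomparable-preserved {y = y} {y′} Xy Xy′ (y≰y′ , y′≰y) =
            (λ up → y≰y′ (collapse up (proj₁ swap up))) ,
            (λ down → y≰y′ (collapse (proj₂ swap down) down))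
            where
            swap : Iff (g y ≤ g y′) (g y′ ≤ g y)
            swap = proj₁ (canonical-pair (orbitPairs-sameTypeOver Xy Xy′ Xy′ Xy
              (⊥-elim ∘ y≰y′ , ⊥-elim ∘ y′≰y) (⊥-elim ∘ y′≰y , ⊥-elim ∘ y≰y′)))
            collapse : g y ≤ g y′ → g y′ ≤ g y → y ≤ y′
            collapse up down = reflexive (g-inj (antisym up down))

          strictPairs-alike : ∀ {x y₀ y₀′ y y′} →
            Orbit _≤_ c x y₀ → Orbit _≤_ c x y₀′ → y₀ < y₀′ →
            Orbit _≤_ c x y → Orbit _≤_ c x y′ → y < y′ →
            Iff (g y₀ ≤ g y₀′) (g y ≤ g y′) × Iff (g y₀′ ≤ g y₀) (g y′ ≤ g y)
          strictPairs-alike X₀ X₀′ y₀<y₀′ Xy Xy′ y<y′ = canonical-pair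
            (orbitPairs-sameTypeOver X₀ X₀′ Xy Xy′
              ((λ _ → proj₁ y<y′) , (λ _ → proj₁ y₀<y₀′))
              (⊥-elim ∘ <⇒≱ y₀<y₀′ , ⊥-elim ∘ <⇒≱ y<y′))

          Trichotomy : (P → Set) → Set
          Trichotomy X = BehavesLikeId _≤_ g X ⊎ BehavesLikeFlip _≤_ g X ⊎ SendsToAntichain g X

          strictPair⇒trichotomy : ExcludedMiddle 0ℓ → ∀ {x y₀ y₀′} →
            Orbit _≤_ c x y₀ → Orbit _≤_ c x y₀′ → y₀ < y₀′ → Trichotomy (Orbit _≤_ c x)
          strictPair⇒trichotomy em {x} {y₀} {y₀′} X₀ X₀′ y₀<y₀′ =
            decide (em {g y₀ ≤ g y₀′}) (em {g y₀′ ≤ g y₀})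
            where
            alike : ∀ {y y′} → Orbit _≤_ c x y → Orbit _≤_ c x y′ → y < y′ →
              Iff (g y₀ ≤ g y₀′) (g y ≤ g y′) × Iff (g y₀′ ≤ g y₀) (g y′ ≤ g y)
            alike = strictPairs-alike X₀ X₀′ y₀<y₀′
            decide : Dec (g y₀ ≤ g y₀′) → Dec (g y₀′ ≤ g y₀) → Trichotomy (Orbit _≤_ c x)
            decide (yes up) _ = inj₁ λ y y′ Xy Xy′ →
              (λ y<y′ → proj₁ (proj₁ (alike Xy Xy′ y<y′)) up , proj₂ y<y′ ∘ g-inj) ,
              incomparable-preserved Xy Xy′
            decide (no _) (yes down) = inj₂ (inj₁ λ y y′ Xy Xy′ →
              (λ y<y′ → proj₁ (proj₂ (alike Xy Xy′ y<y′)) down , proj₂ y<y′ ∘ g-inj ∘ sym) ,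
              incomparable-preserved Xy Xy′)
            decide (no ¬up) (no ¬down) = inj₂ (inj₂ antichain)
              where
              antichain : SendsToAntichain g (Orbit _≤_ c x)
              antichain y y′ Xy Xy′ y≢y′ with em {y ≤ y′} | em {y′ ≤ y}
              ... | yes y≤y′ | _ = let (up , down) = alike Xy Xy′ (y≤y′ , y≢y′) in
                ¬up ∘ proj₂ up , ¬down ∘ proj₂ down
              ... | no _ | yes y′≤y = let (up , down) = alike Xy′ Xy (y′≤y , y≢y′ ∘ sym) in
                ¬down ∘ proj₂ down , ¬up ∘ proj₂ up
              ... | no y≰y′ | no y′≰y = incomparable-preserved Xy Xy′ (y≰y′ , y′≰y)

          orbitTrichotomy : ExcludedMiddle 0ℓ → ∀ x → Trichotomy (Orbit _≤_ c x)
          orbitTrichotomy em x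
            with em {∃[ y₀ ] ∃[ y₀′ ] Orbit _≤_ c x y₀ × Orbit _≤_ c x y₀′ × y₀ < y₀′}
          ... | yes (_ , _ , X₀ , X₀′ , y₀<y₀′) = strictPair⇒trichotomy em X₀ X₀′ y₀<y₀′
          ... | no noStrictPair = inj₁ λ y y′ Xy Xy′ →
            (λ y<y′ → ⊥-elim (noStrictPair (y , y′ , Xy , Xy′ , y<y′))) ,
            incomparable-preserved Xy Xy′

mainTheorem13 : ExcludedMiddle 0ℓ →
    {P : Set} (_≤_ : Rel P 0ℓ) → IsRandomPartialOrder _≤_ →
    (G : (P → P) → Set) → IsClosedSubgroup _≤_ G →
    (∀ f → IsAut _≤_ f → G f) →
    (n : ℕ) (c : Fin n → P) (g : P → P) →
    Canonical _≤_ c g → MGenerated _≤_ G g →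
    IsFullSym _≤_ G ⊎
      (∀ x → Infinite _≤_ (Orbit _≤_ c x) →
        BehavesLikeId _≤_ g (Orbit _≤_ c x) ⊎ BehavesLikeFlip _≤_ g (Orbit _≤_ c x))
mainTheorem13 em {P} _≤_ (isPO , _ , hom , univ) G closed@(perm , _ , comp , _) autG n c g can mg
  with em {IsFullSym _≤_ G}
... | yes full = inj₁ full
... | no notFull = inj₂ behaviour
  where
  _≟_ : DecidableEquality P
  _≟_ _ _ = em
  behaviour : ∀ x → Infinite _≤_ (Orbit _≤_ c x) →
    BehavesLikeId _≤_ g (Orbit _≤_ c x) ⊎ BehavesLikeFlip _≤_ g (Orbit _≤_ c x)
  behaviour x infinite
    with orbitTrichotomy _≤_ isPO hom c can (mgenerated-injective _≤_ perm mg) em x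
  ... | inj₁ likeId = inj₁ likeId
  ... | inj₂ (inj₁ likeFlip) = inj₂ likeFlip
  ... | inj₂ (inj₂ g⊥) = ⊥-elim (notFull (flattensToAntichains⇒fullSym _≤_ isPO hom _≟_ closed autG
          (orbitAntichain⇒flattensToAntichains _≤_ isPO hom c _≟_ univ comp autG mg
            (infiniteOrbit-avoidsConstants _≤_ infinite) g⊥)))
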